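{- Let $G=(V,E)$ be a simple undirected graph with $n$ vertices, $m$ edges and maximum degree $\Delta \geq n^{1/3}$. Let $\psi$ be any partial proper edge coloring of $G$ with colors from $\{1,\ldots,\Delta+1\}$, and let $x \in \{1,\ldots,\Delta+1\}$ be any color. For each $y \in \{1,\ldots,\Delta+1\}\setminus\{x\}$, let $L_{x,y}$ denote the total length (number of edges) of all $\{x,y\}$-alternating paths of length at least $2$. Then $\sum_{y \neq x} L_{x,y} < 3m$.
   Context: A partial proper edge coloring is a map $\psi: E \to \{\bot,1,\ldots,\Delta+1\}$ (where $\bot$ means uncolored) such that no two distinct edges sharing an endpoint receive the same color from $\{1,\ldots,\Delta+1\}$. For a vertex $v$, $\mathsf{miss}_\psi(v)$ is the set of colors in $\{1,\ldots,\Delta+1\}$ not assigned by $\psi$ to any edge incident to $v$. For distinct colors $x,y$, an $\{x,y\}$-alternating path is a maximal simple path $P=\langle u_0,u_1,\ldots,u_k\rangle$ in $G$ all of whose edges receive colors in $\{x,y\}$ under $\psi$, such that each of $u_0$ and $u_k$ is missing exactly one color of $\{x,y\}$; its length is $k$. -}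

module Defs where

open import Data.Nat using (ℕ; zero; suc; _+_; _*_; _∸_; _^_; _≤_; _<_; _⊔_)
open import Data.Fin using (Fin; toℕ)
open import Data.Bool using (Bool; true; false; if_then_else_; _∧_)
open import Data.Maybe using (Maybe; just; nothing)
open import Data.List using (List; []; _∷_; _∷ʳ_; allFin; map; foldr; length; head; last; reverse)
open import Data.List.Membership.Propositional using (_∈_; _∉_)
open import Data.List.Relation.Unary.Unique.Propositional using (Unique)
open import Data.List.Relation.Unary.AllPairs using (AllPairs)
open import Data.Product using (_×_; Σ)
open import Data.Sum using (_⊎_)
open import Data.Unit using (⊤)
open import Relation.Nullary using (¬_; ⌊_⌋)
open import Relation.Binary.PropositionalEquality using (_≡_; _≢_)
open import Data.Fin using (_≟_)
open import Data.Nat using (_<ᵇ_)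
open import Data.Nat.ListAction using (sum)

ΣFin : {k : ℕ} → (Fin k → ℕ) → ℕ
ΣFin {k} f = sum (map f (allFin k))

record Graph (n : ℕ) : Set where
  field
    adj   : Fin n → Fin n → Bool
    sym   : ∀ u v → adj u v ≡ adj v u
    irrefl : ∀ v → adj v v ≡ false
open Graph public

bit : Bool → ℕ
bit true  = 1
bit false = 0

degree : {n : ℕ} → Graph n → Fin n → ℕ
degree G v = ΣFin (λ w → bit (adj G v w))

maxDegree : {n : ℕ} → Graph n → ℕ
maxDegree {n} G = foldr _⊔_ 0 (map (degree G) (allFin n))

edgeCount : {n : ℕ} → Graph n → ℕ
edgeCount G = ΣFin (λ u → ΣFin (λ v → bit ((toℕ u <ᵇ toℕ v) ∧ adj G u v)))

-- Colors {1,…,Δ+1} are represented by Fin (suc Δ); nothing = ⊥ (uncolored).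
-- A partial proper edge coloring of G with colors from Fin k.
record PartialColoring {n : ℕ} (G : Graph n) (k : ℕ) : Set where
  field
    col      : Fin n → Fin n → Maybe (Fin k)
    col-sym  : ∀ u v → col u v ≡ col v u
    col-edge : ∀ u v c → col u v ≡ just c → adj G u v ≡ true
    proper   : ∀ u v w c → col u v ≡ just c → col u w ≡ just c → v ≡ w
open PartialColoring public

module _ {n k : ℕ} {G : Graph n} (ψ : PartialColoring G k) where

  Missing : Fin n → Fin k → Set
  Missing v c = ∀ w → col ψ v w ≢ just c

  MissesExactlyOne : Fin k → Fin k → Fin n → Set
  MissesExactlyOne x y v =
    (Missing v x × ¬ Missing v y) ⊎ (¬ Missing v x × Missing v y)

  ColoredXY : Fin k → Fin k → List (Fin n) → Set
  ColoredXY x y (u ∷ v ∷ rest) =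
    (col ψ u v ≡ just x ⊎ col ψ u v ≡ just y) × ColoredXY x y (v ∷ rest)
  ColoredXY x y _ = ⊤

  XYPath : Fin k → Fin k → List (Fin n) → Set
  XYPath x y p = (p ≢ []) × Unique p × ColoredXY x y p

  Maximal : Fin k → Fin k → List (Fin n) → Set
  Maximal x y p = ∀ w → ¬ XYPath x y (w ∷ p) × ¬ XYPath x y (p ∷ʳ w)

  AltPath : Fin k → Fin k → List (Fin n) → Set
  AltPath x y p = XYPath x y p × Maximal x y p
    × (∀ u → head p ≡ just u → MissesExactlyOne x y u)
    × (∀ u → last p ≡ just u → MissesExactlyOne x y u)

  pathLength : List (Fin n) → ℕ
  pathLength p = length p ∸ 1

  -- `ps` lists every {x,y}-alternating path of length ≥ 2 exactly once
  -- (a path and its reversal are the same undirected path).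
  EnumeratesLongAltPaths : Fin k → Fin k → List (List (Fin n)) → Set
  EnumeratesLongAltPaths x y ps =
    (∀ p → p ∈ ps → AltPath x y p × 2 ≤ pathLength p)
    × (∀ p → AltPath x y p → 2 ≤ pathLength p → p ∈ ps ⊎ reverse p ∈ ps)
    × AllPairs (λ p q → p ≢ q × p ≢ reverse q) ps

  totalLength : List (List (Fin n)) → ℕ
  totalLength ps = sum (map pathLength ps)

ΣOthers : {k : ℕ} → Fin k → (Fin k → ℕ) → ℕ
ΣOthers x g = ΣFin (λ y → if ⌊ y ≟ x ⌋ then 0 else g y)

-- For y ≠ x, charge each {x,y}-alternating path of length ℓ ≥ 2 to its y-coloured edges.
-- Consecutive edges of the path have different colours, so at least ⌊ℓ/2⌋ ≥ 1 of them are
-- y-coloured and ℓ ≤ 3·#(charged edges). Properness leaves an {x,y}-path at most one way to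
-- continue, and none past a vertex missing x or y, so an alternating path is determined up to
-- reversal by any one of its edges: distinct paths are charged to distinct edges, and distinct
-- colours y to distinct edges as well. So the sum is at most 3 times the number of charged edges,
-- which is less than m: an x-coloured edge of any long path is never charged, and if there is no
-- long path, any edge of G (one exists since Δ ≥ n^{1/3} > 0) is uncharged.

module Submission where

open import Defs hiding (sym)
open import Level using (Level)
open import Function using (_∘_; _on_)
open import Function.Bundles using (Equivalence)
open import Data.Nat using (ℕ; zero; suc; _+_; _*_; _∸_; _^_; _≤_; _<_; _<ᵇ_; z≤n; s≤s; z<s)
open import Data.Nat.Properties
  using (≤-refl; ≤-trans; n≤1+n; +-mono-≤; +-monoʳ-≤; +-monoˡ-≤; *-monoʳ-<; *-suc; *-distribˡ-+;
         +-identityˡ; ⊔-identityˡ; <⇒<ᵇ; module ≤-Reasoning)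
open import Data.Nat.ListAction using (sum)
open import Data.Bool using (Bool; true; false; T; if_then_else_; _∧_)
open import Data.Bool.Properties using (T-∧; T-≡)
open import Data.Fin as Fin using (Fin; toℕ; _≟_)
open import Data.Fin.Properties using (<-cmp)
open import Data.Maybe using (Maybe; just)
open import Data.Maybe.Properties using (just-injective) renaming (≡-dec to ≡-decᵐ)
open import Data.Product using (_×_; _,_; proj₁; proj₂; ∃; ∃₂; swap)
open import Data.Product.Properties using (×-≡,≡←≡)
open import Data.Sum using (_⊎_; inj₁; inj₂; [_,_]′)
open import Data.List using (List; []; _∷_; _++_; [_]; length; map; foldr; concatMap; filter; reverse; reverseAcc; head; last; allFin)
open import Data.List.Properties using (length-++; filter-accept; map-cong; reverse-involutive; reverse-injective; ++-ʳ++; ʳ++-defn)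
open import Data.List.Membership.Propositional using (_∈_; _∉_; lose; find)
open import Data.List.Membership.Propositional.Properties
  using (∈-concatMap⁺; ∈-concatMap⁻; ∈-filter⁻; ∈-∃++; ∈-++⁻; ∈-++⁺ˡ; ∈-++⁺ʳ; ∈-allFin)
open import Data.List.Relation.Binary.Subset.Propositional using (_⊆_)
open import Data.List.Relation.Binary.Disjoint.Propositional using (Disjoint)
open import Data.List.Relation.Binary.Permutation.Propositional using (↭⇒↭ₛ; ↭-sym)
open import Data.List.Relation.Binary.Permutation.Propositional.Properties using (↭-reverse; shift; ↭-length)
open import Data.List.Relation.Unary.Any using (Any; here; there)
import Data.List.Relation.Unary.All as All
import Data.List.Relation.Unary.All.Properties as All
open import Data.List.Relation.Unary.All using (All; []; _∷_)
open import Data.List.Relation.Unary.AllPairs using (AllPairs; []; _∷_)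
import Data.List.Relation.Unary.AllPairs as AllPairs
import Data.List.Relation.Unary.AllPairs.Properties as AllPairs
open import Data.List.Relation.Unary.Linked using (Linked; []; [-]; _∷_)
import Data.List.Relation.Unary.Linked as Linked
open import Data.List.Relation.Unary.Unique.Propositional using (Unique)
open import Data.List.Relation.Unary.Unique.Propositional.Properties using (concat⁺; filter⁺; allFin⁺)
open import Relation.Binary.Core using (Rel)
open import Relation.Binary.Definitions using (Symmetric; tri<; tri≈; tri>)
open import Algebra.Definitions using (LeftIdentity)
open import Relation.Binary.PropositionalEquality using (_≡_; _≢_; refl; sym; trans; cong; cong₂; subst; subst₂; setoid)
open import Relation.Nullary using (yes; no; ⌊_⌋; contradiction)
open import Relation.Unary using (Pred; Decidable)

private
  variable
    ℓ ℓ₁ ℓ₂ : Level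
    A : Set ℓ₁
    B : Set ℓ₂

length-concatMap : (f : A → List B) (xs : List A) → length (concatMap f xs) ≡ sum (map (length ∘ f) xs)
length-concatMap f []       = refl
length-concatMap f (x ∷ xs) = trans (length-++ (f x)) (cong (length (f x) +_) (length-concatMap f xs))

sum≤*length-concatMap : ∀ c (f : A → ℕ) (g : A → List B) xs → (∀ {x} → x ∈ xs → f x ≤ c * length (g x))
  → sum (map f xs) ≤ c * length (concatMap g xs)
sum≤*length-concatMap c f g []       _     = z≤n
sum≤*length-concatMap c f g (x ∷ xs) f≤cg = begin
  f x + sum (map f xs)                           ≤⟨ +-mono-≤ (f≤cg (here refl)) (sum≤*length-concatMap c f g xs (f≤cg ∘ there)) ⟩
  c * length (g x) + c * length (concatMap g xs) ≡⟨ *-distribˡ-+ c (length (g x)) _ ⟨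
  c * (length (g x) + length (concatMap g xs))   ≡⟨ cong (c *_) (length-++ (g x)) ⟨
  c * length (concatMap g (x ∷ xs))              ∎
  where open ≤-Reasoning

unique-⊆⇒length≤ : {xs ys : List A} → Unique xs → xs ⊆ ys → length xs ≤ length ys
unique-⊆⇒length≤ {xs = []}     _            _   = z≤n
unique-⊆⇒length≤ {xs = x ∷ xs} (x∉xs ∷ !xs) sub with ∈-∃++ (sub (here refl))
... | ys₁ , ys₂ , refl = begin
  suc (length xs)              ≤⟨ s≤s (unique-⊆⇒length≤ !xs xs⊆) ⟩
  length (x ∷ ys₁ ++ ys₂)      ≡⟨ ↭-length (shift x ys₁ ys₂) ⟨
  length (ys₁ ++ x ∷ ys₂)      ∎
  where
  open ≤-Reasoning
  xs⊆ : xs ⊆ ys₁ ++ ys₂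
  xs⊆ {z} z∈xs with ∈-++⁻ ys₁ (sub (there z∈xs))
  ... | inj₁ z∈ys₁         = ∈-++⁺ˡ z∈ys₁
  ... | inj₂ (here refl)   = contradiction refl (All.lookup x∉xs z∈xs)
  ... | inj₂ (there z∈ys₂) = ∈-++⁺ʳ ys₁ z∈ys₂

module _ {P : Pred A ℓ} (P? : Decidable P) where

  length-filter-∷ : ∀ x xs → length (filter P? xs) ≤ length (filter P? (x ∷ xs))
  length-filter-∷ x xs with P? x
  ... | yes _ = n≤1+n _
  ... | no  _ = ≤-refl

  length-filter-pair : ∀ {x y} xs → P x ⊎ P y → suc (length (filter P? xs)) ≤ length (filter P? (x ∷ y ∷ xs))
  length-filter-pair {x} {y} xs (inj₁ px) rewrite filter-accept P? {x} {y ∷ xs} px = s≤s (length-filter-∷ y xs)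
  length-filter-pair {x} {y} xs (inj₂ py) =
    subst (_≤ length (filter P? (x ∷ y ∷ xs))) (cong length (filter-accept P? py)) (length-filter-∷ x (y ∷ xs))

  length≤1+2*length-filter : ∀ {xs} → Linked (λ x y → P x ⊎ P y) xs → length xs ≤ suc (2 * length (filter P? xs))
  length≤1+2*length-filter []  = z≤n
  length≤1+2*length-filter [-] = s≤s z≤n
  length≤1+2*length-filter {x ∷ y ∷ xs} (pxy ∷ linked) = begin
    2 + length xs                            ≤⟨ +-monoʳ-≤ 2 (length≤1+2*length-filter (Linked.tail linked)) ⟩
    suc (2 + 2 * length (filter P? xs))      ≡⟨ cong suc (*-suc 2 _) ⟨
    suc (2 * suc (length (filter P? xs)))    ≤⟨ s≤s (+-mono-≤ fewer (+-monoˡ-≤ 0 fewer)) ⟩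
    suc (2 * length (filter P? (x ∷ y ∷ xs))) ∎
    where
    open ≤-Reasoning
    fewer : suc (length (filter P? xs)) ≤ length (filter P? (x ∷ y ∷ xs))
    fewer = length-filter-pair xs pxy

  length≤3*length-filter : ∀ {xs} → 2 ≤ length xs → Linked (λ x y → P x ⊎ P y) xs → length xs ≤ 3 * length (filter P? xs)
  length≤3*length-filter (s≤s ()) [-]
  length≤3*length-filter {x ∷ y ∷ xs} _ linked@(pxy ∷ _) =
    ≤-trans (length≤1+2*length-filter linked) (+-monoˡ-≤ (2 * length (filter P? (x ∷ y ∷ xs))) (≤-trans (s≤s z≤n) (length-filter-pair xs pxy)))

linked-⊎⇒Any : {P : Pred A ℓ} {xs : List A} → 2 ≤ length xs → Linked (λ x y → P x ⊎ P y) xs → Any P xs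
linked-⊎⇒Any (s≤s ()) [-]
linked-⊎⇒Any _ (inj₁ px ∷ _) = here px
linked-⊎⇒Any _ (inj₂ py ∷ _) = there (here py)

head-reverseAcc : ∀ (acc : List A) x xs → head (reverseAcc acc (x ∷ xs)) ≡ last (x ∷ xs)
head-reverseAcc acc x []       = refl
head-reverseAcc acc x (y ∷ xs) = head-reverseAcc (x ∷ acc) y xs

head-reverse : (xs : List A) → head (reverse xs) ≡ last xs
head-reverse []       = refl
head-reverse (x ∷ xs) = head-reverseAcc [] x xs

last-reverse : (xs : List A) → last (reverse xs) ≡ head xs
last-reverse xs = trans (sym (head-reverse (reverse xs))) (cong head (reverse-involutive xs))

reverse-++-∷-∷ : ∀ (xs : List A) x y ys → reverse (xs ++ x ∷ y ∷ ys) ≡ reverse ys ++ y ∷ x ∷ reverse xs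
reverse-++-∷-∷ xs x y ys = trans (++-ʳ++ xs) (ʳ++-defn ys)

Unique-reverse : {xs : List A} → Unique xs → Unique (reverse xs)
Unique-reverse {A = A} {xs = xs} = Unique-resp-↭ (↭⇒↭ₛ (↭-sym (↭-reverse xs)))
  where open import Data.List.Relation.Binary.Permutation.Setoid.Properties (setoid A) using (Unique-resp-↭)

module _ {R : Rel A ℓ} (R-sym : Symmetric R) where

  Linked-reverseAcc : ∀ {x} acc xs → Linked R (x ∷ acc) → Linked R (x ∷ xs) → Linked R (reverseAcc acc (x ∷ xs))
  Linked-reverseAcc acc []       linked-acc _              = linked-acc
  Linked-reverseAcc acc (y ∷ xs) linked-acc (rxy ∷ linked) = Linked-reverseAcc (_ ∷ acc) xs (R-sym rxy ∷ linked-acc) linked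

  Linked-reverse : ∀ {xs} → Linked R xs → Linked R (reverse xs)
  Linked-reverse {[]}     []     = []
  Linked-reverse {x ∷ xs} linked = Linked-reverseAcc [] xs [-] linked

AllPairs-map∈ : {R S : Rel A ℓ} {xs : List A} → (∀ {x y} → x ∈ xs → y ∈ xs → R x y → S x y) → AllPairs R xs → AllPairs S xs
AllPairs-map∈ f []           = []
AllPairs-map∈ f (rx ∷ pairs) =
  All.tabulate (λ y∈ → f (here refl) (there y∈) (All.lookup rx y∈)) ∷ AllPairs-map∈ (λ x∈ y∈ → f (there x∈) (there y∈)) pairs

∃-∉ : {P : Pred A ℓ} (xs : List A) → ∃ P → (∀ {x} → x ∈ xs → ∃ λ y → P y × y ∉ xs) → ∃ λ y → P y × y ∉ xs
∃-∉ []       (y , py) _     = y , py , λ ()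
∃-∉ (x ∷ xs) _        fresh = fresh (here refl)

foldr-map-positive : {_∙_ : ℕ → ℕ → ℕ} → LeftIdentity _≡_ 0 _∙_ → (f : A → ℕ) (xs : List A)
  → 0 < foldr _∙_ 0 (map f xs) → ∃ λ x → 0 < f x
foldr-map-positive idˡ f (x ∷ xs) pos with f x in fx
... | zero  = foldr-map-positive idˡ f xs (subst (0 <_) (idˡ _) pos)
... | suc _ = x , subst (0 <_) (sym fx) z<s

0<m^1+n⇒0<m : ∀ m n → 0 < m ^ suc n → 0 < m
0<m^1+n⇒0<m (suc m) n _ = z<s

module _ {n : ℕ} where

  -- Edges are represented by their endpoints in increasing order, as in edgeCount.
  orient : Fin n → Fin n → Fin n × Fin n
  orient a b with <-cmp a b
  ... | tri> _ _ _ = b , a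
  ... | _          = a , b

  orient-cases : ∀ a b → orient a b ≡ (a , b) ⊎ orient a b ≡ (b , a)
  orient-cases a b with <-cmp a b
  ... | tri< _ _ _ = inj₁ refl
  ... | tri≈ _ _ _ = inj₁ refl
  ... | tri> _ _ _ = inj₂ refl

  orient-≡ : ∀ {a b c d} → orient a b ≡ orient c d → (a ≡ c × b ≡ d) ⊎ (a ≡ d × b ≡ c)
  orient-≡ {a} {b} {c} {d} eq with orient-cases a b | orient-cases c d
  ... | inj₁ ab | inj₁ cd = inj₁ (×-≡,≡←≡ (trans (sym ab) (trans eq cd)))
  ... | inj₁ ab | inj₂ dc = inj₂ (×-≡,≡←≡ (trans (sym ab) (trans eq dc)))
  ... | inj₂ ba | inj₁ cd = inj₂ (swap (×-≡,≡←≡ (trans (sym ba) (trans eq cd))))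
  ... | inj₂ ba | inj₂ dc = inj₁ (swap (×-≡,≡←≡ (trans (sym ba) (trans eq dc))))

  edges : List (Fin n) → List (Fin n × Fin n)
  edges (a ∷ b ∷ p) = orient a b ∷ edges (b ∷ p)
  edges _           = []

  length-edges : ∀ p → length (edges p) ≡ length p ∸ 1
  length-edges []          = refl
  length-edges (a ∷ [])    = refl
  length-edges (a ∷ b ∷ p) = cong suc (length-edges (b ∷ p))

  ∈-edges⁻ : ∀ {e p} → e ∈ edges p → ∃₂ λ a b → e ≡ orient a b × ∃₂ λ p₁ p₂ → p ≡ p₁ ++ a ∷ b ∷ p₂
  ∈-edges⁻ {p = a ∷ b ∷ p} (here refl) = a , b , refl , [] , p , refl
  ∈-edges⁻ {p = a ∷ b ∷ p} (there e∈)  with ∈-edges⁻ e∈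
  ... | c , d , refl , p₁ , p₂ , eq = c , d , refl , a ∷ p₁ , p₂ , cong (a ∷_) eq

  endpoints-∈ : ∀ {e p} → e ∈ edges p → proj₁ e ∈ p × proj₂ e ∈ p
  endpoints-∈ {p = a ∷ b ∷ p} (here refl) with orient-cases a b
  ... | inj₁ eq rewrite eq = here refl , there (here refl)
  ... | inj₂ eq rewrite eq = there (here refl) , here refl
  endpoints-∈ {p = a ∷ b ∷ p} (there e∈) with endpoints-∈ e∈
  ... | u∈ , v∈ = there u∈ , there v∈

  edges-unique : ∀ {p} → Unique p → Unique (edges p)
  edges-unique {[]}        _          = []
  edges-unique {a ∷ []}    _          = []
  edges-unique {a ∷ b ∷ p} (a∉ ∷ !bp) = All.tabulate fresh ∷ edges-unique !bp
    where
    fresh : ∀ {e} → e ∈ edges (b ∷ p) → orient a b ≢ e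
    fresh e∈ refl with endpoints-∈ e∈ | orient-cases a b
    ... | (a∈ , _) | inj₁ eq rewrite eq = contradiction refl (All.lookup a∉ a∈)
    ... | (_ , a∈) | inj₂ eq rewrite eq = contradiction refl (All.lookup a∉ a∈)

module _ {n : ℕ} (G : Graph n) where

  isEdge : Fin n → Fin n → Bool
  isEdge u v = (toℕ u <ᵇ toℕ v) ∧ adj G u v

  edgesFrom : Fin n → List (Fin n × Fin n)
  edgesFrom u = concatMap (λ v → if isEdge u v then [ (u , v) ] else []) (allFin n)

  edgeList : List (Fin n × Fin n)
  edgeList = concatMap edgesFrom (allFin n)

  length-edgesFrom : ∀ u → length (edgesFrom u) ≡ ΣFin (bit ∘ isEdge u)
  length-edgesFrom u = trans (length-concatMap _ (allFin n)) (cong sum (map-cong (λ v → length-if (isEdge u v)) (allFin n)))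
    where
    length-if : ∀ {t : Fin n × Fin n} b → length (if b then [ t ] else []) ≡ bit b
    length-if true  = refl
    length-if false = refl

  length-edgeList : length edgeList ≡ edgeCount G
  length-edgeList = trans (length-concatMap edgesFrom (allFin n)) (cong sum (map-cong length-edgesFrom (allFin n)))

  ∈-edgeList⁺ : ∀ {u v} → u Fin.< v → adj G u v ≡ true → (u , v) ∈ edgeList
  ∈-edgeList⁺ {u} {v} u<v uv = ∈-concatMap⁺ _ (lose (∈-allFin u) (∈-concatMap⁺ _ (lose (∈-allFin v) (∈-if edge))))
    where
    ∈-if : ∀ {t : Fin n × Fin n} {b} → T b → t ∈ (if b then [ t ] else [])
    ∈-if {b = true} _ = here refl
    edge : T (isEdge u v)
    edge = Equivalence.from T-∧ (<⇒<ᵇ u<v , Equivalence.from T-≡ uv)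

  orient-∈-edgeList : ∀ {a b} → adj G a b ≡ true → orient a b ∈ edgeList
  orient-∈-edgeList {a} {b} ab with <-cmp a b
  ... | tri< a<b _ _ = ∈-edgeList⁺ a<b ab
  ... | tri≈ _ refl _ = contradiction (trans (sym ab) (irrefl G a)) λ ()
  ... | tri> _ _ b<a = ∈-edgeList⁺ b<a (trans (Graph.sym G b a) ab)

  positive-maxDegree⇒edge : 0 < maxDegree G → ∃₂ λ u v → adj G u v ≡ true
  positive-maxDegree⇒edge Δ>0 with foldr-map-positive ⊔-identityˡ (degree G) (allFin n) Δ>0
  ... | u , deg>0 with foldr-map-positive +-identityˡ (λ v → bit (adj G u v)) (allFin n) deg>0
  ... | v , bit>0 = u , v , bit-positive bit>0
    where
    bit-positive : ∀ {b} → 0 < bit b → b ≡ true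
    bit-positive {true} _ = refl

module _ {n k : ℕ} {G : Graph n} (ψ : PartialColoring G k) where

  colour : Fin n × Fin n → Maybe (Fin k)
  colour (u , v) = col ψ u v

  colour-orient : ∀ a b → colour (orient a b) ≡ col ψ a b
  colour-orient a b with orient-cases a b
  ... | inj₁ eq rewrite eq = refl
  ... | inj₂ eq rewrite eq = col-sym ψ b a

  edgesColoured : Fin k → List (Fin n) → List (Fin n × Fin n)
  edgesColoured z p = filter (λ e → ≡-decᵐ _≟_ (colour e) (just z)) (edges p)

  ∈-edges⇒∈-edgeList : ∀ {e p z} → e ∈ edges p → colour e ≡ just z → e ∈ edgeList G
  ∈-edges⇒∈-edgeList e∈ ez with ∈-edges⁻ e∈
  ... | a , b , refl , _ = orient-∈-edgeList G (col-edge ψ a b _ (trans (sym (colour-orient a b)) ez))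

module Alternation {n k : ℕ} {G : Graph n} (ψ : PartialColoring G k) (x y : Fin k) where

  InXY : Maybe (Fin k) → Set
  InXY c = c ≡ just x ⊎ c ≡ just y

  BothColours : Maybe (Fin k) → Maybe (Fin k) → Set
  BothColours c d = (c ≡ just x ⊎ d ≡ just x) × (c ≡ just y ⊎ d ≡ just y)

  two-colours : ∀ {c d e} → InXY c → InXY d → InXY e → c ≢ e → d ≢ e → c ≡ d
  two-colours (inj₁ refl) (inj₁ refl) _           _   _   = refl
  two-colours (inj₂ refl) (inj₂ refl) _           _   _   = refl
  two-colours (inj₁ refl) (inj₂ refl) (inj₁ refl) c≢e _   = contradiction refl c≢e
  two-colours (inj₁ refl) (inj₂ refl) (inj₂ refl) _   d≢e = contradiction refl d≢e
  two-colours (inj₂ refl) (inj₁ refl) (inj₁ refl) _   d≢e = contradiction refl d≢e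
  two-colours (inj₂ refl) (inj₁ refl) (inj₂ refl) c≢e _   = contradiction refl c≢e

  other-colours : ∀ {c d} → InXY c → InXY d → c ≢ d → BothColours c d
  other-colours (inj₁ refl) (inj₁ refl) c≢d = contradiction refl c≢d
  other-colours (inj₁ refl) (inj₂ refl) _   = inj₁ refl , inj₂ refl
  other-colours (inj₂ refl) (inj₁ refl) _   = inj₂ refl , inj₁ refl
  other-colours (inj₂ refl) (inj₂ refl) c≢d = contradiction refl c≢d

  XY : Fin n → Fin n → Set
  XY a b = InXY (col ψ a b)

  XY-sym : ∀ {a b} → XY a b → XY b a
  XY-sym {a} {b} = subst InXY (col-sym ψ a b)

  coloured⇒linked : ∀ p → ColoredXY ψ x y p → Linked XY p
  coloured⇒linked []          _           = []
  coloured⇒linked (a ∷ [])    _           = [-]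
  coloured⇒linked (a ∷ b ∷ p) (ab , rest) = ab ∷ coloured⇒linked (b ∷ p) rest

  proper-XY : ∀ {b c d} → XY b c → col ψ b c ≡ col ψ b d → c ≡ d
  proper-XY (inj₁ bc) eq = proper ψ _ _ _ x bc (trans (sym eq) bc)
  proper-XY (inj₂ bc) eq = proper ψ _ _ _ y bc (trans (sym eq) bc)

  next-unique : ∀ {a b c d} → a ≢ c → a ≢ d → XY a b → XY b c → XY b d → c ≡ d
  next-unique a≢c a≢d ab bc bd =
    proper-XY bc (two-colours bc bd (XY-sym ab) (a≢c ∘ sym ∘ proper-XY bc) (a≢d ∘ sym ∘ proper-XY bd))

  End : Fin n → Set
  End = MissesExactlyOne ψ x y

  end-unique : ∀ {a b c} → End b → XY a b → XY b c → a ≡ c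
  end-unique (inj₁ (miss-x , _)) ab bc = proper-XY (XY-sym ab) (two-colours (XY-sym ab) bc (inj₁ refl) (miss-x _) (miss-x _))
  end-unique (inj₂ (_ , miss-y)) ab bc = proper-XY (XY-sym ab) (two-colours (XY-sym ab) bc (inj₂ refl) (miss-y _) (miss-y _))

  record PathToEnd (p : List (Fin n)) : Set where
    constructor pathToEnd
    field
      simple   : Unique p
      coloured : Linked XY p
      ends     : ∀ u → last p ≡ just u → End u

  PathToEnd-tail : ∀ {a b p} → PathToEnd (a ∷ b ∷ p) → PathToEnd (b ∷ p)
  PathToEnd-tail (pathToEnd (_ ∷ !p) (_ ∷ linked) ends) = pathToEnd !p linked ends

  PathToEnd-suffix : ∀ p₁ {a p₂} → PathToEnd (p₁ ++ a ∷ p₂) → PathToEnd (a ∷ p₂)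
  PathToEnd-suffix []           t = t
  PathToEnd-suffix (c ∷ [])     t = PathToEnd-tail t
  PathToEnd-suffix (c ∷ d ∷ p₁) t = PathToEnd-suffix (d ∷ p₁) (PathToEnd-tail t)

  PathToEnd-determined : ∀ {a b s t} → PathToEnd (a ∷ b ∷ s) → PathToEnd (a ∷ b ∷ t) → s ≡ t
  PathToEnd-determined {s = []} {[]} _ _ = refl
  PathToEnd-determined {s = []} {c ∷ t} (pathToEnd _ (ab ∷ _) ends) (pathToEnd ((_ ∷ a≢c ∷ _) ∷ _) (_ ∷ bc ∷ _) _) =
    contradiction (end-unique (ends _ refl) ab bc) a≢c
  PathToEnd-determined {s = c ∷ s} {[]} (pathToEnd ((_ ∷ a≢c ∷ _) ∷ _) (_ ∷ bc ∷ _) _) (pathToEnd _ (ab ∷ _) ends) =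
    contradiction (end-unique (ends _ refl) ab bc) a≢c
  PathToEnd-determined {s = c ∷ s} {d ∷ t}
    ps@(pathToEnd ((_ ∷ a≢c ∷ _) ∷ _) (ab ∷ bc ∷ _) _) pt@(pathToEnd ((_ ∷ a≢d ∷ _) ∷ _) (_ ∷ bd ∷ _) _)
    with refl ← next-unique a≢c a≢d ab bc bd = cong (c ∷_) (PathToEnd-determined (PathToEnd-tail ps) (PathToEnd-tail pt))

  Alternating : List (Fin n) → Set
  Alternating p = PathToEnd p × PathToEnd (reverse p)

  altPath⇒alternating : ∀ {p} → AltPath ψ x y p → Alternating p
  altPath⇒alternating {p} ((_ , !p , coloured) , _ , starts , ends) =
    pathToEnd !p linked ends ,
    pathToEnd (Unique-reverse !p) (Linked-reverse XY-sym linked) (λ u eq → starts u (trans (sym (last-reverse p)) eq))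
    where
    linked : Linked XY p
    linked = coloured⇒linked p coloured

  alternating-reverse : ∀ {p} → Alternating p → Alternating (reverse p)
  alternating-reverse {p} (forwards , backwards) = backwards , subst PathToEnd (sym (reverse-involutive p)) forwards

  alternating-determined : ∀ p₁ {a b} p₂ q₁ q₂ → Alternating (p₁ ++ a ∷ b ∷ p₂) → Alternating (q₁ ++ a ∷ b ∷ q₂)
    → p₁ ++ a ∷ b ∷ p₂ ≡ q₁ ++ a ∷ b ∷ q₂
  alternating-determined p₁ {a} {b} p₂ q₁ q₂ (fp , bp) (fq , bq) = cong₂ (λ l r → l ++ a ∷ b ∷ r) p₁≡q₁ p₂≡q₂
    where
    p₂≡q₂ : p₂ ≡ q₂
    p₂≡q₂ = PathToEnd-determined (PathToEnd-suffix p₁ fp) (PathToEnd-suffix q₁ fq)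
    backwards : ∀ l r → PathToEnd (reverse (l ++ a ∷ b ∷ r)) → PathToEnd (b ∷ a ∷ reverse l)
    backwards l r t = PathToEnd-suffix (reverse r) (subst PathToEnd (reverse-++-∷-∷ l a b r) t)
    p₁≡q₁ : p₁ ≡ q₁
    p₁≡q₁ = reverse-injective (PathToEnd-determined (backwards p₁ p₂ bp) (backwards q₁ q₂ bq))

  shared-edge⇒same-path : ∀ {p q e} → Alternating p → Alternating q → e ∈ edges p → e ∈ edges q → p ≡ q ⊎ p ≡ reverse q
  shared-edge⇒same-path altp altq e∈p e∈q with ∈-edges⁻ e∈p | ∈-edges⁻ e∈q
  ... | a , b , refl , p₁ , p₂ , refl | c , d , ab≡cd , q₁ , q₂ , refl with orient-≡ ab≡cd
  ... | inj₁ (refl , refl) = inj₁ (alternating-determined p₁ p₂ q₁ q₂ altp altq)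
  ... | inj₂ (refl , refl) = inj₂ (trans
        (alternating-determined p₁ p₂ (reverse q₂) (reverse q₁) altp (subst Alternating reversed (alternating-reverse altq)))
        (sym reversed))
    where
    reversed : reverse (q₁ ++ b ∷ a ∷ q₂) ≡ reverse q₂ ++ a ∷ b ∷ reverse q₁
    reversed = reverse-++-∷-∷ q₁ b a q₂

  edges-alternate : ∀ {p} → Unique p → Linked XY p → Linked (BothColours on colour ψ) (edges p)
  edges-alternate {[]}            _ _ = []
  edges-alternate {a ∷ []}        _ _ = []
  edges-alternate {a ∷ b ∷ []}    _ _ = [-]
  edges-alternate {a ∷ b ∷ c ∷ p} ((_ ∷ a≢c ∷ _) ∷ !p) (ab ∷ bc ∷ linked) = alternate ∷ edges-alternate !p (bc ∷ linked)
    where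
    alternate : BothColours (colour ψ (orient a b)) (colour ψ (orient b c))
    alternate = subst₂ BothColours (sym (colour-orient ψ a b)) (sym (colour-orient ψ b c))
      (other-colours ab bc (λ eq → a≢c (proper-XY (XY-sym ab) (trans (col-sym ψ b a) eq))))

  alternating-edgesColoured-unique : ∀ {p} → Alternating p → Unique (edgesColoured ψ y p)
  alternating-edgesColoured-unique (pathToEnd !p _ _ , _) = filter⁺ _ (edges-unique !p)

  pathLength≤3*length-edgesColoured : ∀ {p} → Alternating p → 2 ≤ pathLength ψ p → pathLength ψ p ≤ 3 * length (edgesColoured ψ y p)
  pathLength≤3*length-edgesColoured {p} (pathToEnd !p linked _ , _) long =
    subst (_≤ 3 * length (edgesColoured ψ y p)) (length-edges p)
      (length≤3*length-filter _ (subst (2 ≤_) (sym (length-edges p)) long) (Linked.map proj₂ (edges-alternate !p linked)))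

  long-path-has-x-edge : ∀ {p} → Alternating p → 2 ≤ pathLength ψ p → ∃ λ e → e ∈ edges p × colour ψ e ≡ just x
  long-path-has-x-edge {p} (pathToEnd !p linked _ , _) long =
    find (linked-⊎⇒Any (subst (2 ≤_) (sym (length-edges p)) long) (Linked.map proj₁ (edges-alternate !p linked)))

module Counting {n k : ℕ} {G : Graph n} (ψ : PartialColoring G k) (x : Fin k)
  (Ls : Fin k → List (List (Fin n))) (enum : ∀ y → y ≢ x → EnumeratesLongAltPaths ψ x y (Ls y)) where

  open module Alt y = Alternation ψ x y
    using (Alternating; altPath⇒alternating; shared-edge⇒same-path; alternating-edgesColoured-unique; pathLength≤3*length-edgesColoured; long-path-has-x-edge)

  alternating : ∀ {y p} → y ≢ x → p ∈ Ls y → Alternating y p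
  alternating {y} y≢x p∈ = altPath⇒alternating y (proj₁ (proj₁ (enum y y≢x) _ p∈))

  long : ∀ {y p} → y ≢ x → p ∈ Ls y → 2 ≤ pathLength ψ p
  long {y} y≢x p∈ = proj₂ (proj₁ (enum y y≢x) _ p∈)

  chargedEdges : Fin k → List (Fin n × Fin n)
  chargedEdges y with y ≟ x
  ... | yes _ = []
  ... | no  _ = concatMap (edgesColoured ψ y) (Ls y)

  charged : List (Fin n × Fin n)
  charged = concatMap chargedEdges (allFin k)

  ∈-chargedEdges⁻ : ∀ {y t} → t ∈ chargedEdges y → y ≢ x × colour ψ t ≡ just y × ∃ λ p → p ∈ Ls y × t ∈ edges p
  ∈-chargedEdges⁻ {y} t∈ with y ≟ x
  ∈-chargedEdges⁻ {y} ()  | yes _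
  ∈-chargedEdges⁻ {y} t∈ | no y≢x with find (∈-concatMap⁻ (edgesColoured ψ y) t∈)
  ... | p , p∈ , t∈p with ∈-filter⁻ _ t∈p
  ... | t∈edges , ty = y≢x , ty , p , p∈ , t∈edges

  chargedEdges-colour : ∀ {y t} → t ∈ chargedEdges y → colour ψ t ≡ just y
  chargedEdges-colour t∈ = proj₁ (proj₂ (∈-chargedEdges⁻ t∈))

  ∈-charged⁻ : ∀ {t} → t ∈ charged → ∃ λ y → y ≢ x × colour ψ t ≡ just y × ∃ λ p → p ∈ Ls y × t ∈ edges p
  ∈-charged⁻ t∈ with find (∈-concatMap⁻ chargedEdges {xs = allFin k} t∈)
  ... | y , _ , t∈y = y , ∈-chargedEdges⁻ t∈y

  charged-colour≢x : ∀ {t} → t ∈ charged → colour ψ t ≢ just x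
  charged-colour≢x t∈ tx with _ , y≢x , ty , _ ← ∈-charged⁻ t∈ = y≢x (just-injective (trans (sym ty) tx))

  chargedEdges-unique : ∀ y → Unique (chargedEdges y)
  chargedEdges-unique y with y ≟ x
  ... | yes _   = []
  ... | no y≢x  = concat⁺
    (All.map⁺ (All.tabulate λ p∈ → alternating-edgesColoured-unique y (alternating y≢x p∈)))
    (AllPairs.map⁺ (AllPairs-map∈ disjoint (proj₂ (proj₂ (enum y y≢x)))))
    where
    disjoint : ∀ {p q} → p ∈ Ls y → q ∈ Ls y → p ≢ q × p ≢ reverse q → Disjoint (edgesColoured ψ y p) (edgesColoured ψ y q)
    disjoint p∈ q∈ (p≢q , p≢q⁻¹) (t∈p , t∈q) =
      [ p≢q , p≢q⁻¹ ]′ (shared-edge⇒same-path y (alternating y≢x p∈) (alternating y≢x q∈)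
                                               (proj₁ (∈-filter⁻ _ t∈p)) (proj₁ (∈-filter⁻ _ t∈q)))

  charged-unique : Unique charged
  charged-unique = concat⁺ (All.map⁺ (All.tabulate λ {y} _ → chargedEdges-unique y)) (AllPairs.map⁺ (AllPairs.map disjoint (allFin⁺ k)))
    where
    disjoint : ∀ {y y′} → y ≢ y′ → Disjoint (chargedEdges y) (chargedEdges y′)
    disjoint y≢y′ (t∈y , t∈y′) = y≢y′ (just-injective (trans (sym (chargedEdges-colour t∈y)) (chargedEdges-colour t∈y′)))

  charged⊆edgeList : charged ⊆ edgeList G
  charged⊆edgeList t∈ with ∈-charged⁻ t∈
  ... | _ , _ , ty , _ , _ , t∈p = ∈-edges⇒∈-edgeList ψ t∈p ty

  sum≤3*length-charged : ΣOthers x (λ y → totalLength ψ (Ls y)) ≤ 3 * length charged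
  sum≤3*length-charged = sum≤*length-concatMap 3 _ chargedEdges (allFin k) (λ {y} _ → bound y)
    where
    bound : ∀ y → (if ⌊ y ≟ x ⌋ then 0 else totalLength ψ (Ls y)) ≤ 3 * length (chargedEdges y)
    bound y with y ≟ x
    ... | yes _  = z≤n
    ... | no y≢x = sum≤*length-concatMap 3 (pathLength ψ) (edgesColoured ψ y) (Ls y)
                     (λ p∈ → pathLength≤3*length-edgesColoured y (alternating y≢x p∈) (long y≢x p∈))

  uncharged-edge : ∃₂ (λ u v → adj G u v ≡ true) → ∃ λ e → e ∈ edgeList G × e ∉ charged
  uncharged-edge (u , v , uv) = ∃-∉ charged (orient u v , orient-∈-edgeList G uv) x-edge
    where
    x-edge : ∀ {t} → t ∈ charged → ∃ λ e → e ∈ edgeList G × e ∉ charged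
    x-edge t∈ with ∈-charged⁻ t∈
    ... | y , y≢x , _ , p , p∈ , _ with long-path-has-x-edge y (alternating y≢x p∈) (long y≢x p∈)
    ... | e , e∈p , ex = e , ∈-edges⇒∈-edgeList ψ e∈p ex , λ e∈ → charged-colour≢x e∈ ex

  sum<3*edgeCount : ∃₂ (λ u v → adj G u v ≡ true) → ΣOthers x (λ y → totalLength ψ (Ls y)) < 3 * edgeCount G
  sum<3*edgeCount edge with e , e∈E , e∉ ← uncharged-edge edge = begin-strict
    ΣOthers x (λ y → totalLength ψ (Ls y)) ≤⟨ sum≤3*length-charged ⟩
    3 * length charged                     <⟨ *-monoʳ-< 3 charged<edgeCount ⟩
    3 * edgeCount G                        ∎
    where
    open ≤-Reasoning
    charged<edgeCount : length charged < edgeCount G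
    charged<edgeCount = subst (length charged <_) (length-edgeList G)
      (unique-⊆⇒length≤ (All.¬Any⇒All¬ charged e∉ ∷ charged-unique) λ { (here refl) → e∈E ; (there t∈) → charged⊆edgeList t∈ })

lemma3p1 : (n : ℕ) → 1 ≤ n → (G : Graph n) → n ≤ maxDegree G ^ 3
    → (ψ : PartialColoring G (suc (maxDegree G))) → (x : Fin (suc (maxDegree G)))
    → (Ls : Fin (suc (maxDegree G)) → List (List (Fin n)))
    → (∀ y → y ≢ x → EnumeratesLongAltPaths ψ x y (Ls y))
    → ΣOthers x (λ y → totalLength ψ (Ls y)) < 3 * edgeCount G
lemma3p1 n 1≤n G n≤Δ³ ψ x Ls enum =
  Counting.sum<3*edgeCount ψ x Ls enum (positive-maxDegree⇒edge G (0<m^1+n⇒0<m (maxDegree G) 2 (≤-trans 1≤n n≤Δ³)))
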